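{- Let $G,H$ be connected graphs. Then $\iota(G\,\Box\,H)=\iota(G)+\iota(H)$, with $\iota(G\,\Box\,H)=\infty$ if either $\iota(G)=\infty$ or $\iota(H)=\infty$.
   Context: All graphs are finite, simple, undirected. For a connected graph $G$ with vertices $v_1,\dots,v_n$, $D=(d(v_i,v_j))_{i,j}$ is its shortest-path distance matrix and $\vec 1$ the all-ones vector. A curvature potential is a vector $\vec x$ with $D\vec x=\vec 1$; $G$ is distance exceptional if it has no curvature potential. Let $X(G)=\{D\vec x:\vec x\in\mathbb{R}^n,\ \vec x^\top\vec 1=1\}$. If $G$ is distance exceptional or has a curvature potential $\vec x$ with $\vec 1^\top\vec x\ne 0$, then $X(G)\cap\mathbb{R}\vec 1$ is a single point, and the curvature index $\iota(G)\in\mathbb{R}$ is defined by $X(G)\cap\mathbb{R}\vec 1=\{\iota(G)\vec 1\}$; otherwise $\iota(G):=\infty$. The Cartesian product $G\,\Box\,H$ has vertex set $V(G)\times V(H)$, with $(u,v)$ adjacent to $(u',v')$ iff either $u=u'$ and $\{v,v'\}\in E(H)$, or $v=v'$ and $\{u,u'\}\in E(G)$.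
   Formalization: Curvature potentials and the vectors $\vec x$ defining $X(G)$ have rational entries, and the curvature index takes values in ℚ together with ∞ rather than in ℝ together with ∞. -}

module Defs where

open import Data.Nat using (ℕ; zero; suc; _≤_)
open import Data.Fin using (Fin; remQuot)
import Data.Fin as Fin
open import Data.Integer using (+_)
open import Data.Rational using (ℚ; 0ℚ; 1ℚ; _+_; _*_; _/_)
open import Data.Product using (Σ; _×_; _,_; ∃)
open import Data.Sum using (_⊎_)
open import Relation.Binary.PropositionalEquality using (_≡_; _≢_)
open import Relation.Nullary using (¬_)

record Graph : Set₁ where
  constructor mkGraph
  field
    n   : ℕ
    Adj : Fin n → Fin n → Set
open Graph public

IsSimple : Graph → Set
IsSimple G = (∀ i j → Adj G i j → Adj G j i) × (∀ i → ¬ Adj G i i)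

data Walk (G : Graph) : Fin (n G) → Fin (n G) → ℕ → Set where
  nil  : ∀ {i} → Walk G i i 0
  cons : ∀ {i j k l} → Adj G i j → Walk G j k l → Walk G i k (suc l)

Connected : Graph → Set
Connected G = (1 ≤ n G) × (∀ i j → ∃ λ l → Walk G i j l)

IsDist : (G : Graph) → Fin (n G) → Fin (n G) → ℕ → Set
IsDist G i j d = Walk G i j d × (∀ l → Walk G i j l → d ≤ l)

IsDistMatrix : (G : Graph) → (Fin (n G) → Fin (n G) → ℕ) → Set
IsDistMatrix G D = ∀ i j → IsDist G i j (D i j)

_□_ : Graph → Graph → Graph
G □ H = mkGraph (n G Data.Nat.* n H) adj
  where
  adj : Fin (n G Data.Nat.* n H) → Fin (n G Data.Nat.* n H) → Set
  adj p q with remQuot {n G} (n H) p | remQuot {n G} (n H) q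
  ... | (u , v) | (u' , v') = (u ≡ u' × Adj H v v') ⊎ (v ≡ v' × Adj G u u')

sumℚ : ∀ {m} → (Fin m → ℚ) → ℚ
sumℚ {zero}  f = 0ℚ
sumℚ {suc m} f = f Fin.zero + sumℚ (λ i → f (Fin.suc i))

ℕtoℚ : ℕ → ℚ
ℕtoℚ k = + k / 1

_·_ : ∀ {m} → (Fin m → Fin m → ℕ) → (Fin m → ℚ) → (Fin m → ℚ)
(D · x) i = sumℚ (λ j → ℕtoℚ (D i j) * x j)

IsPotential : ∀ {m} → (Fin m → Fin m → ℕ) → (Fin m → ℚ) → Set
IsPotential D x = ∀ i → (D · x) i ≡ 1ℚ

DistanceExceptional : ∀ {m} → (Fin m → Fin m → ℕ) → Set
DistanceExceptional D = ¬ (∃ λ x → IsPotential D x)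

InX : ∀ {m} → (Fin m → Fin m → ℕ) → ℚ → Set
InX D r = ∃ λ x → (sumℚ x ≡ 1ℚ) × (∀ i → (D · x) i ≡ r)

FiniteCase : ∀ {m} → (Fin m → Fin m → ℕ) → Set
FiniteCase D = DistanceExceptional D ⊎ (∃ λ x → IsPotential D x × sumℚ x ≢ 0ℚ)

data ℚ∞ : Set where
  fin : ℚ → ℚ∞
  ∞   : ℚ∞

_⊕_ : ℚ∞ → ℚ∞ → ℚ∞
fin a ⊕ fin b = fin (a + b)
fin a ⊕ ∞     = ∞
∞     ⊕ _     = ∞

-- curvature index of a matrix: ι = r iff in the finite case and X ∩ ℚ1 ∋ r1
-- (this intersection is a single point in that case); ι = ∞ otherwise
IndexOf : ∀ {m} → (Fin m → Fin m → ℕ) → ℚ∞ → Set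
IndexOf D (fin r) = FiniteCase D × InX D r
IndexOf D ∞       = ¬ FiniteCase D

CurvatureIndex : Graph → ℚ∞ → Set
CurvatureIndex G a = Σ (Fin (n G) → Fin (n G) → ℕ) λ D → IsDistMatrix G D × IndexOf D a

{-# OPTIONS --safe #-}
module Submission where

-- Distances in G □ H add up coordinatewise, so its distance matrix is D_G ⊞ D_H, and on
-- product vectors (D_G ⊞ D_H)(x ⊗ y) = (D_G x)·Σy + Σx·(D_H y).  If x and y witness
-- ι(G) = r and ι(H) = s (Σx = Σy = 1, D x constant), then x ⊗ y witnesses r + s.  If
-- ι(G) = ∞, every potential x of G has Σx = 0, and x ⊗ w with Σw = 1 is again a potential
-- of G □ H with sum 0.  Which case applies is decided by the symmetry of distance matrices:
-- if D z = c·1 and D p = 1, then c·Σp = ⟨D z, p⟩ = ⟨z, D p⟩ = Σz.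

open import Defs
open import Algebra.Bundles using (CommutativeRing)
open import Data.Fin using (Fin; combine; quotient; remainder; _↑ˡ_; _↑ʳ_)
import Data.Fin as Fin
open import Data.Fin.Properties using (remQuot-combine; combine-remQuot)
import Data.Integer as ℤ
import Data.Integer.Properties as ℤ
open import Data.Nat as ℕ using (ℕ; zero; suc; _≤_)
open import Data.Nat.Properties using (≤-antisym; +-suc; +-mono-≤)
open import Data.Product using (∃; ∃₂; _×_; _,_; proj₁; proj₂)
open import Data.Rational using (ℚ; 0ℚ; 1ℚ; _+_; _*_; _/_; 1/_; ≢-nonZero; toℚᵘ; fromℚᵘ)
open import Data.Rational.Properties
  using ( _≟_; 1≢0; +-identityˡ; +-identityʳ; +-assoc; *-identityˡ; *-identityʳ; *-zeroˡ; *-zeroʳ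
        ; *-assoc; *-comm; *-inverseˡ; +-*-commutativeRing
        ; fromℚᵘ-cong; fromℚᵘ-toℚᵘ; toℚᵘ-fromℚᵘ; toℚᵘ-homo-+ )
open import Data.Rational.Solver using (module +-*-Solver)
import Data.Rational.Unnormalised as ℚᵘ
import Data.Rational.Unnormalised.Properties as ℚᵘ
open import Data.Sum using (inj₁; inj₂)
open import Relation.Binary.PropositionalEquality
open import Relation.Nullary using (¬_; yes; no)
open import Relation.Nullary.Decidable using (decidable-stable)

open import Algebra.Properties.Semiring.Sum (CommutativeRing.semiring +-*-commutativeRing)
  using (sum; sum-cong-≗; ∑-distrib-+; ∑-comm; *-distribˡ-sum; *-distribʳ-sum; sum-replicate-zero)

open ≡-Reasoning

module _ {G : Graph} where

  _++ʷ_ : ∀ {i j k l l′} → Walk G i j l → Walk G j k l′ → Walk G i k (l ℕ.+ l′)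
  nil      ++ʷ w′ = w′
  cons a w ++ʷ w′ = cons a (w ++ʷ w′)

  _∷ʳʷ_ : ∀ {i j k l} → Walk G i j l → Adj G j k → Walk G i k (suc l)
  nil      ∷ʳʷ a = cons a nil
  cons b w ∷ʳʷ a = cons b (w ∷ʳʷ a)

  reverseʷ : IsSimple G → ∀ {i j l} → Walk G i j l → Walk G j i l
  reverseʷ S nil        = nil
  reverseʷ S (cons a w) = reverseʷ S w ∷ʳʷ proj₁ S _ _ a

IsSymmetric : ∀ {m} → (Fin m → Fin m → ℕ) → Set
IsSymmetric D = ∀ i j → D i j ≡ D j i

dist-sym : ∀ {G D} → IsSimple G → IsDistMatrix G D → IsSymmetric D
dist-sym S isD i j = ≤-antisym (proj₂ (isD i j) _ (reverseʷ S (proj₁ (isD j i))))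
                               (proj₂ (isD j i) _ (reverseʷ S (proj₁ (isD i j))))

module _ {m k : ℕ} where

  _⊞_ : (Fin m → Fin m → ℕ) → (Fin k → Fin k → ℕ) → Fin (m ℕ.* k) → Fin (m ℕ.* k) → ℕ
  (DG ⊞ DH) p q = DG (quotient {m} k p) (quotient {m} k q) ℕ.+ DH (remainder {m} k p) (remainder {m} k q)

  _⊗_ : (Fin m → ℚ) → (Fin k → ℚ) → Fin (m ℕ.* k) → ℚ
  (x ⊗ y) p = x (quotient {m} k p) * y (remainder {m} k p)

  quotient-combine : ∀ u v → quotient {m} k (combine u v) ≡ u
  quotient-combine u v = cong proj₁ (remQuot-combine {m} {k} u v)

  remainder-combine : ∀ u v → remainder {m} k (combine u v) ≡ v
  remainder-combine u v = cong proj₂ (remQuot-combine {m} {k} u v)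

module _ (G H : Graph) where

  □-adjˡ : ∀ {u u′} v → Adj G u u′ → Adj (G □ H) (combine u v) (combine u′ v)
  □-adjˡ {u} {u′} v a = inj₂ ( trans (remainder-combine u v) (sym (remainder-combine u′ v))
                             , subst₂ (Adj G) (sym (quotient-combine u v)) (sym (quotient-combine u′ v)) a )

  □-adjʳ : ∀ u {v v′} → Adj H v v′ → Adj (G □ H) (combine u v) (combine u v′)
  □-adjʳ u {v} {v′} a = inj₁ ( trans (quotient-combine u v) (sym (quotient-combine u v′))
                             , subst₂ (Adj H) (sym (remainder-combine u v)) (sym (remainder-combine u v′)) a )

  □-walkˡ : ∀ {u u′ l} v → Walk G u u′ l → Walk (G □ H) (combine u v) (combine u′ v) l
  □-walkˡ v nil        = nil
  □-walkˡ v (cons a w) = cons (□-adjˡ v a) (□-walkˡ v w)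

  □-walkʳ : ∀ u {v v′ l} → Walk H v v′ l → Walk (G □ H) (combine u v) (combine u v′) l
  □-walkʳ u nil        = nil
  □-walkʳ u (cons a w) = cons (□-adjʳ u a) (□-walkʳ u w)

  private
    π₁ = quotient {n G} (n H)
    π₂ = remainder {n G} (n H)

  □-walk : ∀ {p q l l′} → Walk G (π₁ p) (π₁ q) l → Walk H (π₂ p) (π₂ q) l′ → Walk (G □ H) p q (l ℕ.+ l′)
  □-walk {p} {q} wG wH =
    subst₂ (λ s t → Walk (G □ H) s t _) (combine-remQuot {n G} (n H) p) (combine-remQuot {n G} (n H) q)
           (□-walkˡ (π₂ p) wG ++ʷ □-walkʳ (π₁ q) wH)

  □-walk-split : ∀ {p q l} → Walk (G □ H) p q l →
                 ∃₂ λ a b → a ℕ.+ b ≡ l × Walk G (π₁ p) (π₁ q) a × Walk H (π₂ p) (π₂ q) b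
  □-walk-split nil = 0 , 0 , refl , nil , nil
  □-walk-split (cons (inj₁ (e , aH)) w) with a , b , refl , wG , wH ← □-walk-split w
    = a , suc b , +-suc a b , subst (λ s → Walk G s _ a) (sym e) wG , cons aH wH
  □-walk-split (cons (inj₂ (e , aG)) w) with a , b , refl , wG , wH ← □-walk-split w
    = suc a , b , refl , cons aG wG , subst (λ s → Walk H s _ b) (sym e) wH

  □-isDistMatrix : ∀ {DG DH} → IsDistMatrix G DG → IsDistMatrix H DH → IsDistMatrix (G □ H) (DG ⊞ DH)
  □-isDistMatrix {DG} {DH} isDG isDH p q = □-walk (proj₁ (isDG _ _)) (proj₁ (isDH _ _)) , shortest
    where
    shortest : ∀ l → Walk (G □ H) p q l → (DG ⊞ DH) p q ≤ l
    shortest _ w with a , b , refl , wG , wH ← □-walk-split w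
      = +-mono-≤ (proj₂ (isDG _ _) a wG) (proj₂ (isDH _ _) b wH)

sumℚ≗sum : ∀ {m} (f : Fin m → ℚ) → sumℚ f ≡ sum f
sumℚ≗sum {zero}  f = refl
sumℚ≗sum {suc m} f = cong (f Fin.zero +_) (sumℚ≗sum (λ i → f (Fin.suc i)))

module _ {m : ℕ} where

  sumℚ-cong : ∀ {f g : Fin m → ℚ} → (∀ i → f i ≡ g i) → sumℚ f ≡ sumℚ g
  sumℚ-cong {f} {g} f≗g = begin
    sumℚ f ≡⟨ sumℚ≗sum f ⟩
    sum f  ≡⟨ sum-cong-≗ f≗g ⟩
    sum g  ≡⟨ sumℚ≗sum g ⟨
    sumℚ g ∎

  sumℚ-zero : sumℚ {m} (λ _ → 0ℚ) ≡ 0ℚ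
  sumℚ-zero = trans (sumℚ≗sum {m} (λ _ → 0ℚ)) (sum-replicate-zero m)

  sumℚ-distrib-+ : ∀ (f g : Fin m → ℚ) → sumℚ (λ i → f i + g i) ≡ sumℚ f + sumℚ g
  sumℚ-distrib-+ f g = begin
    sumℚ (λ i → f i + g i) ≡⟨ sumℚ≗sum (λ i → f i + g i) ⟩
    sum (λ i → f i + g i)  ≡⟨ ∑-distrib-+ f g ⟩
    sum f + sum g          ≡⟨ cong₂ _+_ (sumℚ≗sum f) (sumℚ≗sum g) ⟨
    sumℚ f + sumℚ g        ∎

  *-distribˡ-sumℚ : ∀ c (f : Fin m → ℚ) → c * sumℚ f ≡ sumℚ (λ i → c * f i)
  *-distribˡ-sumℚ c f = begin
    c * sumℚ f            ≡⟨ cong (c *_) (sumℚ≗sum f) ⟩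
    c * sum f             ≡⟨ *-distribˡ-sum c f ⟩
    sum (λ i → c * f i)   ≡⟨ sumℚ≗sum (λ i → c * f i) ⟨
    sumℚ (λ i → c * f i)  ∎

  *-distribʳ-sumℚ : ∀ c (f : Fin m → ℚ) → sumℚ f * c ≡ sumℚ (λ i → f i * c)
  *-distribʳ-sumℚ c f = begin
    sumℚ f * c            ≡⟨ cong (_* c) (sumℚ≗sum f) ⟩
    sum f * c             ≡⟨ *-distribʳ-sum c f ⟩
    sum (λ i → f i * c)   ≡⟨ sumℚ≗sum (λ i → f i * c) ⟨
    sumℚ (λ i → f i * c)  ∎

  sumℚ-comm : ∀ {k} (f : Fin m → Fin k → ℚ) →
              sumℚ (λ i → sumℚ (f i)) ≡ sumℚ (λ j → sumℚ (λ i → f i j))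
  sumℚ-comm f = begin
    sumℚ (λ i → sumℚ (f i))         ≡⟨ sumℚ≗sum (λ i → sumℚ (f i)) ⟩
    sum (λ i → sumℚ (f i))          ≡⟨ sum-cong-≗ (λ i → sumℚ≗sum (f i)) ⟩
    sum (λ i → sum (f i))           ≡⟨ ∑-comm f ⟩
    sum (λ j → sum (λ i → f i j))   ≡⟨ sum-cong-≗ (λ j → sumℚ≗sum (λ i → f i j)) ⟨
    sum (λ j → sumℚ (λ i → f i j))  ≡⟨ sumℚ≗sum (λ j → sumℚ (λ i → f i j)) ⟨
    sumℚ (λ j → sumℚ (λ i → f i j)) ∎

sumℚ-↑ : ∀ m {k} (f : Fin (m ℕ.+ k) → ℚ) → sumℚ f ≡ sumℚ (λ i → f (i ↑ˡ k)) + sumℚ (λ j → f (m ↑ʳ j))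
sumℚ-↑ zero    f = sym (+-identityˡ _)
sumℚ-↑ (suc m) f =
  trans (cong (f Fin.zero +_) (sumℚ-↑ m (λ i → f (Fin.suc i)))) (sym (+-assoc (f Fin.zero) _ _))

sumℚ-combine : ∀ m {k} (f : Fin (m ℕ.* k) → ℚ) →
               sumℚ f ≡ sumℚ (λ u → sumℚ (λ v → f (combine {m} {k} u v)))
sumℚ-combine zero        f = refl
sumℚ-combine (suc m) {k} f =
  trans (sumℚ-↑ k f) (cong (sumℚ (λ v → f (v ↑ˡ (m ℕ.* k))) +_) (sumℚ-combine m (λ p → f (k ↑ʳ p))))

sumℚ-remQuot : ∀ {m k} (g : Fin m → Fin k → ℚ) →
               sumℚ (λ p → g (quotient {m} k p) (remainder {m} k p)) ≡ sumℚ (λ u → sumℚ (g u))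
sumℚ-remQuot {m} g = trans (sumℚ-combine m _)
  (sumℚ-cong (λ u → sumℚ-cong (λ v → cong₂ g (quotient-combine u v) (remainder-combine u v))))

∃-sumℚ≡1 : ∀ {m} → 1 ≤ m → ∃ λ (w : Fin m → ℚ) → sumℚ w ≡ 1ℚ
∃-sumℚ≡1 {suc m} _ =
  (λ { Fin.zero → 1ℚ ; (Fin.suc _) → 0ℚ }) , trans (cong (1ℚ +_) (sumℚ-zero {m})) (+-identityʳ 1ℚ)

ℕtoℚ-+ : ∀ a b → ℕtoℚ (a ℕ.+ b) ≡ ℕtoℚ a + ℕtoℚ b
-- The chain typechecks because ℕtoℚ k unfolds to fromℚᵘ (ℕᵘ k).
ℕtoℚ-+ a b = begin
  ℕtoℚ (a ℕ.+ b)
    ≡⟨ cong (_/ 1) (cong₂ ℤ._+_ (ℤ.*-identityʳ (ℤ.+ a)) (ℤ.*-identityʳ (ℤ.+ b))) ⟨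
  fromℚᵘ (ℕᵘ a ℚᵘ.+ ℕᵘ b)
    ≡⟨ fromℚᵘ-cong (ℚᵘ.+-cong (toℚᵘ-fromℚᵘ (ℕᵘ a)) (toℚᵘ-fromℚᵘ (ℕᵘ b))) ⟨
  fromℚᵘ (toℚᵘ (ℕtoℚ a) ℚᵘ.+ toℚᵘ (ℕtoℚ b))
    ≡⟨ fromℚᵘ-cong (toℚᵘ-homo-+ (ℕtoℚ a) (ℕtoℚ b)) ⟨
  fromℚᵘ (toℚᵘ (ℕtoℚ a + ℕtoℚ b))
    ≡⟨ fromℚᵘ-toℚᵘ _ ⟩
  ℕtoℚ a + ℕtoℚ b ∎
  where
  ℕᵘ : ℕ → ℚᵘ.ℚᵘ
  ℕᵘ k = ℚᵘ.mkℚᵘ (ℤ.+ k) 0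

module _ {m : ℕ} (D : Fin m → Fin m → ℕ) where

  ·-*ˡ : ∀ c z i → (D · (λ j → c * z j)) i ≡ c * (D · z) i
  ·-*ˡ c z i = begin
    sumℚ (λ j → ℕtoℚ (D i j) * (c * z j)) ≡⟨ sumℚ-cong (λ j → reorder (ℕtoℚ (D i j)) (z j)) ⟩
    sumℚ (λ j → c * (ℕtoℚ (D i j) * z j)) ≡⟨ *-distribˡ-sumℚ c (λ j → ℕtoℚ (D i j) * z j) ⟨
    c * (D · z) i                          ∎
    where
    reorder : ∀ d x → d * (c * x) ≡ c * (d * x)
    reorder d x = trans (sym (*-assoc d c x)) (trans (cong (_* x) (*-comm d c)) (*-assoc c d x))

  ·-self-adjoint : IsSymmetric D → ∀ p z → sumℚ (λ i → p i * (D · z) i) ≡ sumℚ (λ j → (D · p) j * z j)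
  ·-self-adjoint symD p z = begin
    sumℚ (λ i → p i * (D · z) i)
      ≡⟨ sumℚ-cong (λ i → *-distribˡ-sumℚ (p i) (λ j → ℕtoℚ (D i j) * z j)) ⟩
    sumℚ (λ i → sumℚ (λ j → p i * (ℕtoℚ (D i j) * z j)))
      ≡⟨ sumℚ-comm (λ i j → p i * (ℕtoℚ (D i j) * z j)) ⟩
    sumℚ (λ j → sumℚ (λ i → p i * (ℕtoℚ (D i j) * z j)))
      ≡⟨ sumℚ-cong (λ j → sumℚ-cong (λ i → entry i j)) ⟩
    sumℚ (λ j → sumℚ (λ i → (ℕtoℚ (D j i) * p i) * z j))
      ≡⟨ sumℚ-cong (λ j → *-distribʳ-sumℚ (z j) (λ i → ℕtoℚ (D j i) * p i)) ⟨
    sumℚ (λ j → (D · p) j * z j) ∎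
    where
    entry : ∀ i j → p i * (ℕtoℚ (D i j) * z j) ≡ (ℕtoℚ (D j i) * p i) * z j
    entry i j = begin
      p i * (ℕtoℚ (D i j) * z j) ≡⟨ *-assoc (p i) _ (z j) ⟨
      (p i * ℕtoℚ (D i j)) * z j ≡⟨ cong (_* z j) (*-comm (p i) _) ⟩
      (ℕtoℚ (D i j) * p i) * z j ≡⟨ cong (λ d → (ℕtoℚ d * p i) * z j) (symD i j) ⟩
      (ℕtoℚ (D j i) * p i) * z j ∎

  potential-pairing : IsSymmetric D → ∀ {z c p} → (∀ i → (D · z) i ≡ c) → IsPotential D p →
                      c * sumℚ p ≡ sumℚ z
  potential-pairing symD {z} {c} {p} Dz≡c Dp≡1 = begin
    c * sumℚ p                   ≡⟨ *-distribˡ-sumℚ c p ⟩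
    sumℚ (λ i → c * p i)         ≡⟨ sumℚ-cong (λ i → trans (*-comm c (p i)) (cong (p i *_) (sym (Dz≡c i)))) ⟩
    sumℚ (λ i → p i * (D · z) i) ≡⟨ ·-self-adjoint symD p z ⟩
    sumℚ (λ j → (D · p) j * z j) ≡⟨ sumℚ-cong (λ j → trans (cong (_* z j) (Dp≡1 j)) (*-identityˡ (z j))) ⟩
    sumℚ z                       ∎

  finiteCase-of-InX : IsSymmetric D → ∀ {r} → InX D r → FiniteCase D
  finiteCase-of-InX symD {r} (z , Σz≡1 , Dz≡r) with r ≟ 0ℚ
  ... | yes refl = inj₁ λ (p , Dp≡1) → 1≢0 (begin
    1ℚ          ≡⟨ Σz≡1 ⟨
    sumℚ z      ≡⟨ potential-pairing symD Dz≡r Dp≡1 ⟨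
    0ℚ * sumℚ p ≡⟨ *-zeroˡ (sumℚ p) ⟩
    0ℚ          ∎)
  ... | no r≢0 = inj₂ ((λ j → 1/ r * z j) , potential , Σ≢0)
    where
    instance _ = ≢-nonZero r≢0
    potential : IsPotential D (λ j → 1/ r * z j)
    potential i = trans (·-*ˡ (1/ r) z i) (trans (cong (1/ r *_) (Dz≡r i)) (*-inverseˡ r))
    Σ≢0 : sumℚ (λ j → 1/ r * z j) ≢ 0ℚ
    Σ≢0 Σ≡0 = 1≢0 (begin
      1ℚ                          ≡⟨ *-inverseˡ r ⟨
      1/ r * r                    ≡⟨ cong (_* r) (*-identityʳ (1/ r)) ⟨
      1/ r * 1ℚ * r               ≡⟨ cong (λ s → 1/ r * s * r) Σz≡1 ⟨
      1/ r * sumℚ z * r           ≡⟨ cong (_* r) (*-distribˡ-sumℚ (1/ r) z) ⟩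
      sumℚ (λ j → 1/ r * z j) * r ≡⟨ cong (_* r) Σ≡0 ⟩
      0ℚ * r                      ≡⟨ *-zeroˡ r ⟩
      0ℚ                          ∎)

  ¬finiteCase-of-null-potential : IsSymmetric D → ∀ {z} → IsPotential D z → sumℚ z ≡ 0ℚ → ¬ FiniteCase D
  ¬finiteCase-of-null-potential _ {z} Dz≡1 _ (inj₁ exceptional) = exceptional (z , Dz≡1)
  ¬finiteCase-of-null-potential symD {z} Dz≡1 Σz≡0 (inj₂ (p , Dp≡1 , Σp≢0)) = Σp≢0 (begin
    sumℚ p      ≡⟨ *-identityˡ (sumℚ p) ⟨
    1ℚ * sumℚ p ≡⟨ potential-pairing symD Dz≡1 Dp≡1 ⟩
    sumℚ z      ≡⟨ Σz≡0 ⟩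
    0ℚ          ∎)

  potential-sum≡0 : ¬ FiniteCase D → ∀ {x} → IsPotential D x → sumℚ x ≡ 0ℚ
  potential-sum≡0 ¬finite {x} Dx≡1 =
    decidable-stable (sumℚ x ≟ 0ℚ) (λ Σx≢0 → ¬finite (inj₂ (x , Dx≡1 , Σx≢0)))

module _ {m k : ℕ} (DG : Fin m → Fin m → ℕ) (DH : Fin k → Fin k → ℕ) where

  ⊞-sym : IsSymmetric DG → IsSymmetric DH → IsSymmetric (DG ⊞ DH)
  ⊞-sym symG symH p q = cong₂ ℕ._+_ (symG _ _) (symH _ _)

  sumℚ-⊗ : ∀ (x : Fin m → ℚ) (y : Fin k → ℚ) → sumℚ (x ⊗ y) ≡ sumℚ x * sumℚ y
  sumℚ-⊗ x y = begin
    sumℚ (x ⊗ y)                        ≡⟨ sumℚ-remQuot (λ u v → x u * y v) ⟩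
    sumℚ (λ u → sumℚ (λ v → x u * y v)) ≡⟨ sumℚ-cong (λ u → *-distribˡ-sumℚ (x u) y) ⟨
    sumℚ (λ u → x u * sumℚ y)           ≡⟨ *-distribʳ-sumℚ (sumℚ y) x ⟨
    sumℚ x * sumℚ y                     ∎

  ·-⊗ : ∀ x y p → ((DG ⊞ DH) · (x ⊗ y)) p ≡
        (DG · x) (quotient {m} k p) * sumℚ y + sumℚ x * (DH · y) (remainder {m} k p)
  ·-⊗ x y p = begin
    ((DG ⊞ DH) · (x ⊗ y)) p
      ≡⟨ sumℚ-remQuot (λ u v → ℕtoℚ (DG a u ℕ.+ DH b v) * (x u * y v)) ⟩
    sumℚ (λ u → sumℚ (λ v → ℕtoℚ (DG a u ℕ.+ DH b v) * (x u * y v)))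
      ≡⟨ sumℚ-cong (λ u → sumℚ-cong (λ v → entry u v)) ⟩
    sumℚ (λ u → sumℚ (λ v → gx u * y v + x u * hy v))
      ≡⟨ sumℚ-cong (λ u → sumℚ-distrib-+ (λ v → gx u * y v) (λ v → x u * hy v)) ⟩
    sumℚ (λ u → sumℚ (λ v → gx u * y v) + sumℚ (λ v → x u * hy v))
      ≡⟨ sumℚ-cong (λ u → cong₂ _+_ (*-distribˡ-sumℚ (gx u) y) (*-distribˡ-sumℚ (x u) hy)) ⟨
    sumℚ (λ u → gx u * sumℚ y + x u * sumℚ hy)
      ≡⟨ sumℚ-distrib-+ (λ u → gx u * sumℚ y) (λ u → x u * sumℚ hy) ⟩
    sumℚ (λ u → gx u * sumℚ y) + sumℚ (λ u → x u * sumℚ hy)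
      ≡⟨ cong₂ _+_ (*-distribʳ-sumℚ (sumℚ y) gx) (*-distribʳ-sumℚ (sumℚ hy) x) ⟨
    sumℚ gx * sumℚ y + sumℚ x * sumℚ hy ∎
    where
    open +-*-Solver
    a = quotient {m} k p
    b = remainder {m} k p
    gx : Fin m → ℚ
    gx u = ℕtoℚ (DG a u) * x u
    hy : Fin k → ℚ
    hy v = ℕtoℚ (DH b v) * y v
    entry : ∀ u v → ℕtoℚ (DG a u ℕ.+ DH b v) * (x u * y v) ≡ gx u * y v + x u * hy v
    entry u v = trans (cong (_* (x u * y v)) (ℕtoℚ-+ (DG a u) (DH b v)))
      (solve 4 (λ g h xu yv → (g :+ h) :* (xu :* yv) := g :* xu :* yv :+ xu :* (h :* yv)) refl
             (ℕtoℚ (DG a u)) (ℕtoℚ (DH b v)) (x u) (y v))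

  InX-⊞ : ∀ {r s} → InX DG r → InX DH s → InX (DG ⊞ DH) (r + s)
  InX-⊞ {r} {s} (x , Σx≡1 , Dx≡r) (y , Σy≡1 , Dy≡s) = x ⊗ y , Σ≡1 , D≡r+s
    where
    Σ≡1 : sumℚ (x ⊗ y) ≡ 1ℚ
    Σ≡1 = trans (sumℚ-⊗ x y) (trans (cong₂ _*_ Σx≡1 Σy≡1) (*-identityˡ 1ℚ))
    D≡r+s : ∀ p → ((DG ⊞ DH) · (x ⊗ y)) p ≡ r + s
    D≡r+s p = begin
      ((DG ⊞ DH) · (x ⊗ y)) p
        ≡⟨ ·-⊗ x y p ⟩
      (DG · x) _ * sumℚ y + sumℚ x * (DH · y) _
        ≡⟨ cong₂ _+_ (cong₂ _*_ (Dx≡r _) Σy≡1) (cong₂ _*_ Σx≡1 (Dy≡s _)) ⟩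
      r * 1ℚ + 1ℚ * s
        ≡⟨ cong₂ _+_ (*-identityʳ r) (*-identityˡ s) ⟩
      r + s ∎

  potential-⊗ˡ : ∀ {x w} → IsPotential DG x → sumℚ x ≡ 0ℚ → sumℚ w ≡ 1ℚ → IsPotential (DG ⊞ DH) (x ⊗ w)
  potential-⊗ˡ {x} {w} Dx≡1 Σx≡0 Σw≡1 p = begin
    ((DG ⊞ DH) · (x ⊗ w)) p          ≡⟨ ·-⊗ x w p ⟩
    (DG · x) _ * sumℚ w + sumℚ x * t ≡⟨ cong₂ _+_ (cong₂ _*_ (Dx≡1 _) Σw≡1) (cong (_* t) Σx≡0) ⟩
    1ℚ * 1ℚ + 0ℚ * t                 ≡⟨ cong₂ _+_ (*-identityˡ 1ℚ) (*-zeroˡ t) ⟩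
    1ℚ + 0ℚ                          ≡⟨ +-identityʳ 1ℚ ⟩
    1ℚ                               ∎
    where t = (DH · w) (remainder {m} k p)

  potential-⊗ʳ : ∀ {w y} → sumℚ w ≡ 1ℚ → IsPotential DH y → sumℚ y ≡ 0ℚ → IsPotential (DG ⊞ DH) (w ⊗ y)
  potential-⊗ʳ {w} {y} Σw≡1 Dy≡1 Σy≡0 p = begin
    ((DG ⊞ DH) · (w ⊗ y)) p          ≡⟨ ·-⊗ w y p ⟩
    t * sumℚ y + sumℚ w * (DH · y) _ ≡⟨ cong₂ _+_ (cong (t *_) Σy≡0) (cong₂ _*_ Σw≡1 (Dy≡1 _)) ⟩
    t * 0ℚ + 1ℚ * 1ℚ                 ≡⟨ cong₂ _+_ (*-zeroʳ t) (*-identityˡ 1ℚ) ⟩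
    0ℚ + 1ℚ                          ≡⟨ +-identityˡ 1ℚ ⟩
    1ℚ                               ∎
    where t = (DG · w) (quotient {m} k p)

  ¬finiteCase-⊞ˡ : IsSymmetric DG → IsSymmetric DH → (∃ λ w → sumℚ w ≡ 1ℚ) →
                   ¬ FiniteCase DG → ¬ FiniteCase (DG ⊞ DH)
  -- Constructively ¬ FiniteCase DG yields no potential of DG, only ¬¬ one, so we refute
  -- exceptionality of DG instead.
  ¬finiteCase-⊞ˡ symG symH (w , Σw≡1) ¬finiteG finite = ¬finiteG (inj₁ λ (x , Dx≡1) →
    let Σx≡0 = potential-sum≡0 DG ¬finiteG Dx≡1 in
    ¬finiteCase-of-null-potential (DG ⊞ DH) (⊞-sym symG symH) (potential-⊗ˡ Dx≡1 Σx≡0 Σw≡1)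
      (trans (sumℚ-⊗ x w) (trans (cong (_* sumℚ w) Σx≡0) (*-zeroˡ (sumℚ w)))) finite)

  ¬finiteCase-⊞ʳ : IsSymmetric DG → IsSymmetric DH → (∃ λ w → sumℚ w ≡ 1ℚ) →
                   ¬ FiniteCase DH → ¬ FiniteCase (DG ⊞ DH)
  ¬finiteCase-⊞ʳ symG symH (w , Σw≡1) ¬finiteH finite = ¬finiteH (inj₁ λ (y , Dy≡1) →
    let Σy≡0 = potential-sum≡0 DH ¬finiteH Dy≡1 in
    ¬finiteCase-of-null-potential (DG ⊞ DH) (⊞-sym symG symH) (potential-⊗ʳ Σw≡1 Dy≡1 Σy≡0)
      (trans (sumℚ-⊗ w y) (trans (cong (sumℚ w *_) Σy≡0) (*-zeroʳ (sumℚ w)))) finite)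

theorem3p4 : (G H : Graph) → IsSimple G → IsSimple H → Connected G → Connected H →
    (a b : ℚ∞) → CurvatureIndex G a → CurvatureIndex H b →
      CurvatureIndex (G □ H) (a ⊕ b)
theorem3p4 G H simpleG simpleH connG connH a b (DG , isDG , ιG) (DH , isDH , ιH) =
  DG ⊞ DH , □-isDistMatrix G H isDG isDH , index a b ιG ιH
  where
  symG = dist-sym simpleG isDG
  symH = dist-sym simpleH isDH
  index : ∀ a b → IndexOf DG a → IndexOf DH b → IndexOf (DG ⊞ DH) (a ⊕ b)
  index (fin _) (fin _) (_ , XG) (_ , XH) = finiteCase-of-InX (DG ⊞ DH) (⊞-sym DG DH symG symH) X , X
    where X = InX-⊞ DG DH XG XH
  index ∞       _       ¬finiteG _        = ¬finiteCase-⊞ˡ DG DH symG symH (∃-sumℚ≡1 (proj₁ connH)) ¬finiteG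
  index (fin _) ∞       _        ¬finiteH = ¬finiteCase-⊞ʳ DG DH symG symH (∃-sumℚ≡1 (proj₁ connG)) ¬finiteH
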